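{- Let $\Omega$ be a countably infinite set and $n\geq 1$. Then $\mathbb{F}_2^{[\Omega]^n}$ has no proper closed $\operatorname{Sym}(\Omega)$-submodule of finite index.
   Context: $[\Omega]^n$ is the set of $n$-element subsets of $\Omega$; $\mathbb{F}_2^{[\Omega]^n}$ is the group of all functions $[\Omega]^n\to\mathbb{F}_2$, with $\operatorname{Sym}(\Omega)$ acting by $f^\sigma(w)=f(w^{\sigma^{ -1}})$. It is viewed as a subgroup of $\operatorname{Sym}([\Omega]^n\times\mathbb{F}_2)$ via $(w,\delta)^f=(w,f(w)+\delta)$, and carries the induced topology of pointwise convergence (equivalently the product topology). A closed submodule is a $\operatorname{Sym}(\Omega)$-invariant subgroup closed in this topology. -}

module Defs where

open import Level using (0ℓ)
open import Data.Nat using (ℕ; _<_; _≤_)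
open import Data.Bool using (Bool; false; _xor_)
open import Data.List using (List; length)
open import Data.List.Relation.Unary.All using (All)
open import Data.List.Relation.Unary.Any using (Any)
open import Data.List.Relation.Unary.Linked using (Linked)
open import Data.List.Membership.Propositional using (_∈_)
open import Data.Product using (Σ; ∃; _×_)
open import Function.Bundles using (_↔_; Inverse; _⇔_)
open import Relation.Binary.PropositionalEquality using (_≡_)
open import Relation.Nullary using (¬_)

-- Ω = ℕ (a countably infinite set).
-- An n-element subset of ℕ, represented canonically by its strictly increasing
-- list of elements; the proofs are irrelevant so two subsets are equal iff
-- their element lists are equal.
record NSub (n : ℕ) : Set where
  constructor mkNSub
  field
    elems      : List ℕ
    .increasing : Linked _<_ elems
    .size       : length elems ≡ n
open NSub public

-- 𝔽₂ = Bool with addition xor.  Elements of 𝔽₂^{[ℕ]^n}: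
Fun : ℕ → Set
Fun n = NSub n → Bool

zeroF : ∀ {n} → Fun n
zeroF _ = false

_⊕_ : ∀ {n} → Fun n → Fun n → Fun n
(f ⊕ g) w = f w xor g w

Perm : Set
Perm = ℕ ↔ ℕ

Image : ∀ {n} → Perm → NSub n → NSub n → Set
Image σ w w' = ∀ x → (x ∈ elems w') ⇔ (∃ λ y → y ∈ elems w × Inverse.to σ y ≡ x)

IsTranslate : ∀ {n} → Perm → Fun n → Fun n → Set
IsTranslate σ f g = ∀ w w' → Image σ w w' → g w' ≡ f w

Subgroup : ∀ {n} → (Fun n → Set) → Set
Subgroup M = M zeroF × (∀ f g → M f → M g → M (f ⊕ g))

Invariant : ∀ {n} → (Fun n → Set) → Set
Invariant M = ∀ σ f g → M f → IsTranslate σ f g → M g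

-- Closed in the topology of pointwise convergence (product topology):
-- every f in the closure of M (every basic neighbourhood of f, determined by
-- a finite set of points, meets M) lies in M.
Closed : ∀ {n} → (Fun n → Set) → Set
Closed {n} M = ∀ f → (∀ (ws : List (NSub n)) → ∃ λ g → M g × All (λ w → f w ≡ g w) ws) → M f

-- Finite index: finitely many coset representatives gs such that every f
-- lies in some coset g + M (i.e. f - g = f ⊕ g ∈ M).
FiniteIndex : ∀ {n} → (Fun n → Set) → Set
FiniteIndex {n} M = ∃ λ (gs : List (Fun n)) → ∀ f → Any (λ g → M (f ⊕ g)) gs

ClosedSubmodule : ∀ {n} → (Fun n → Set) → Set
ClosedSubmodule M = Subgroup M × Invariant M × Closed M

Proper : ∀ {n} → (Fun n → Set) → Set
Proper {n} M = ∃ λ (f : Fun n) → ¬ M f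

-- An indicator δ_W of an n-set W is a limit of elements of M: to make it agree with an element
-- of M on a finite set of points, take |M-cosets| + 1 pairwise disjoint n-sets B_i far beyond
-- those points.  Two of their indicators lie in a common coset, so δ_{B_i} + δ_{B_j} ∈ M, and a
-- permutation swapping B_i with W while fixing B_j carries this to δ_W + δ_{B_j} ∈ M, which
-- agrees with δ_W on the given points.  Hence all indicators lie in M; their finite sums are
-- dense, so M is everything.
module Submission where

open import Defs
open import Data.Nat using (ℕ; zero; suc; _+_; _*_; _≤_; _<_; _≟_; _<?_; s≤s)
open import Data.Nat.Properties
open import Data.Nat.ListAction using (sum)
open import Data.Bool using (false; true; _xor_)
import Data.Bool as Bool
open import Data.Bool.Properties using (¬-not; xor-identityʳ)
open import Data.List using (List; []; _∷_; length; lookup)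
open import Data.List.Properties using (≡-dec)
open import Data.List.Relation.Unary.All as All using (All; []; _∷_)
open import Data.List.Relation.Unary.Any as Any using (here; there)
open import Data.List.Relation.Unary.Any.Properties using (lookup-index)
open import Data.List.Relation.Unary.Linked as Linked using (Linked; []; [-]; _∷_)
open import Data.List.Relation.Unary.Linked.Properties using (Linked⇒All)
open import Data.List.Relation.Binary.Disjoint.Propositional using (Disjoint)
import Data.List.Relation.Binary.Disjoint.Propositional.Properties as Disjoint
open import Data.List.Membership.Propositional using (_∈_; _∉_)
open import Data.Fin using (toℕ)
open import Data.Fin.Properties using (pigeonhole)
open import Data.Empty using (⊥-elim)
open import Data.Product using (∃; ∃₂; _×_; _,_; proj₁; proj₂)
open import Function.Base using (_∘_)
open import Function.Bundles using (Inverse; Equivalence; mk↔ₛ′; mk⇔)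
open import Relation.Binary.Definitions using (DecidableEquality)
open import Relation.Binary.PropositionalEquality
open import Relation.Nullary using (¬_; yes; no; does; recompute; contradiction)

head<tail : ∀ {x xs z} → Linked _<_ (x ∷ xs) → z ∈ xs → x < z
head<tail [-] ()
head<tail (x<y ∷ l) z∈xs = All.lookup (Linked⇒All <-trans x<y l) z∈xs

head≤ : ∀ {x xs z} → Linked _<_ (x ∷ xs) → z ∈ x ∷ xs → x ≤ z
head≤ _ (here refl) = ≤-refl
head≤ l (there z∈xs) = <⇒≤ (head<tail l z∈xs)

head∉tail : ∀ {x xs} → Linked _<_ (x ∷ xs) → x ∉ xs
head∉tail l x∈xs = <-irrefl refl (head<tail l x∈xs)

∈-tail : ∀ {x xs z} → x < z → z ∈ x ∷ xs → z ∈ xs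
∈-tail x<z (here refl) = ⊥-elim (<-irrefl refl x<z)
∈-tail _ (there z∈xs) = z∈xs

Linked<-ext : ∀ {xs ys} → Linked _<_ xs → Linked _<_ ys →
  (∀ {z} → z ∈ xs → z ∈ ys) → (∀ {z} → z ∈ ys → z ∈ xs) → xs ≡ ys
Linked<-ext {[]} {[]} _ _ _ _ = refl
Linked<-ext {[]} {_ ∷ _} _ _ _ ys⊆ with () ← ys⊆ (here refl)
Linked<-ext {_ ∷ _} {[]} _ _ xs⊆ _ with () ← xs⊆ (here refl)
Linked<-ext {x ∷ xs} {y ∷ ys} lx ly xs⊆ ys⊆ =
  cong₂ _∷_ x≡y (Linked<-ext (Linked.tail lx) (Linked.tail ly) tail⊆ tail⊇)
  where
  x≡y : x ≡ y
  x≡y = ≤-antisym (head≤ lx (ys⊆ (here refl))) (head≤ ly (xs⊆ (here refl)))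
  tail⊆ : ∀ {z} → z ∈ xs → z ∈ ys
  tail⊆ z∈xs = ∈-tail (subst (_< _) x≡y (head<tail lx z∈xs)) (xs⊆ (there z∈xs))
  tail⊇ : ∀ {z} → z ∈ ys → z ∈ xs
  tail⊇ z∈ys = ∈-tail (subst (_< _) (sym x≡y) (head<tail ly z∈ys)) (ys⊆ (there z∈ys))

<-separated⇒Disjoint : ∀ {xs ys c} → (∀ {x} → x ∈ xs → x < c) → (∀ {y} → y ∈ ys → c ≤ y) →
  Disjoint xs ys
<-separated⇒Disjoint xs<c c≤ys (x∈xs , x∈ys) = <-irrefl refl (<-≤-trans (xs<c x∈xs) (c≤ys x∈ys))

elems-linked : ∀ {n} (u : NSub n) → Linked _<_ (elems u)
elems-linked (mkNSub xs l _) = recompute (Linked.linked? _<?_ xs) l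

elems-length : ∀ {n} (u : NSub n) → length (elems u) ≡ n
elems-length {n} (mkNSub xs _ p) = recompute (length xs ≟ n) p

elems-injective : ∀ {n} {u v : NSub n} → elems u ≡ elems v → u ≡ v
elems-injective {u = mkNSub _ _ _} {mkNSub _ _ _} refl = refl

NSub-ext : ∀ {n} {u v : NSub n} →
  (∀ {x} → x ∈ elems u → x ∈ elems v) → (∀ {x} → x ∈ elems v → x ∈ elems u) → u ≡ v
NSub-ext {u = u} {v} u⊆v v⊆u = elems-injective (Linked<-ext (elems-linked u) (elems-linked v) u⊆v v⊆u)

_≟ₛ_ : ∀ {n} → DecidableEquality (NSub n)
u ≟ₛ v with ≡-dec _≟_ (elems u) (elems v)
... | yes u≡v = yes (elems-injective u≡v)
... | no u≢v  = no (u≢v ∘ cong elems)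

indicator : ∀ {n} → NSub n → Fun n
indicator w u = does (u ≟ₛ w)

elemsSum : ∀ {n} → List (NSub n) → ℕ
elemsSum [] = 0
elemsSum (u ∷ ws) = sum (elems u) + elemsSum ws

∈⇒≤sum : ∀ {x xs} → x ∈ xs → x ≤ sum xs
∈⇒≤sum {x} {_ ∷ xs} (here refl) = m≤m+n x (sum xs)
∈⇒≤sum {x} {y ∷ _} (there x∈xs) = ≤-trans (∈⇒≤sum x∈xs) (m≤n+m _ y)

∈⇒≤elemsSum : ∀ {n} {ws : List (NSub n)} {u x} → u ∈ ws → x ∈ elems u → x ≤ elemsSum ws
∈⇒≤elemsSum (here refl) x∈u = ≤-trans (∈⇒≤sum x∈u) (m≤m+n _ _)
∈⇒≤elemsSum (there u∈ws) x∈u = ≤-trans (∈⇒≤elemsSum u∈ws x∈u) (m≤n+m _ _)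

intervalList : ℕ → ℕ → List ℕ
intervalList c zero = []
intervalList c (suc n) = c ∷ intervalList (suc c) n

intervalList-linked : ∀ c n → Linked _<_ (intervalList c n)
intervalList-linked c zero = []
intervalList-linked c (suc zero) = [-]
intervalList-linked c (suc (suc n)) = n<1+n c ∷ intervalList-linked (suc c) (suc n)

intervalList-length : ∀ c n → length (intervalList c n) ≡ n
intervalList-length c zero = refl
intervalList-length c (suc n) = cong suc (intervalList-length (suc c) n)

interval : ℕ → (n : ℕ) → NSub n
interval c n = mkNSub (intervalList c n) (intervalList-linked c n) (intervalList-length c n)

interval-lower : ∀ {c n x} → x ∈ elems (interval c n) → c ≤ x
interval-lower {n = suc _} (here refl) = ≤-refl
interval-lower {n = suc _} (there x∈) = <⇒≤ (interval-lower x∈)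

interval-upper : ∀ {c n x} → x ∈ elems (interval c n) → x < c + n
interval-upper {c} {suc n} (here refl) = subst (c <_) (sym (+-suc c n)) (s≤s (m≤m+n c n))
interval-upper {c} {suc n} {x} (there x∈) = subst (x <_) (sym (+-suc c n)) (interval-upper x∈)

module _ (σ : Perm) where
  open Inverse σ using (to; from; strictlyInverseʳ)

  private
    to-injective : ∀ {x y} → to x ≡ to y → x ≡ y
    to-injective {x} {y} e = trans (sym (strictlyInverseʳ x)) (trans (cong from e) (strictlyInverseʳ y))

  Image-functional : ∀ {n} {w v v' : NSub n} → Image σ w v → Image σ w v' → v ≡ v'
  Image-functional im im' =
    NSub-ext (λ {x} → Equivalence.from (im' x) ∘ Equivalence.to (im x))
             (λ {x} → Equivalence.from (im x) ∘ Equivalence.to (im' x))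

  private
    preimage-⊆ : ∀ {n} {w w' v : NSub n} → Image σ w v → Image σ w' v →
      ∀ {x} → x ∈ elems w → x ∈ elems w'
    preimage-⊆ w↦v w'↦v {x} x∈w
      with y , y∈w' , to-y≡to-x ← Equivalence.to (w'↦v (to x)) (Equivalence.from (w↦v (to x)) (x , x∈w , refl))
      = subst (_∈ _) (to-injective to-y≡to-x) y∈w'

  Image-injective : ∀ {n} {w w' v : NSub n} → Image σ w v → Image σ w' v → w ≡ w'
  Image-injective {w = w} {w'} {v} w↦v w'↦v =
    NSub-ext (preimage-⊆ {w = w} {w'} {v} w↦v w'↦v) (preimage-⊆ {w = w'} {w} {v} w'↦v w↦v)

  Image-fixed : ∀ {n} {w : NSub n} → (∀ {x} → x ∈ elems w → to x ≡ x) → Image σ w w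
  Image-fixed {w = w} fixed x = mk⇔
    (λ x∈w → x , x∈w , fixed x∈w)
    (λ (y , y∈w , to-y≡x) → subst (_∈ elems w) (trans (sym (fixed y∈w)) to-y≡x) y∈w)

  indicator-translate : ∀ {n} {w v : NSub n} → Image σ w v →
    IsTranslate σ (indicator w) (indicator v)
  indicator-translate {w = w} {v} w↦v u u' u↦u' with u ≟ₛ w | u' ≟ₛ v
  ... | yes _    | yes _    = refl
  ... | no _     | no _     = refl
  ... | yes refl | no u'≢v  = contradiction (Image-functional {w = w} {u'} {v} u↦u' w↦v) u'≢v
  ... | no u≢w   | yes refl = contradiction (Image-injective {w = u} {w} {v} u↦u' w↦v) u≢w

IsTranslate-⊕ : ∀ {n σ} {f f' g g' : Fun n} →
  IsTranslate σ f g → IsTranslate σ f' g' → IsTranslate σ (f ⊕ f') (g ⊕ g')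
IsTranslate-⊕ t t' u u' u↦u' = cong₂ _xor_ (t u u' u↦u') (t' u u' u↦u')

-- The permutation exchanging the i-th elements of two lists

swapLists : List ℕ → List ℕ → ℕ → ℕ
swapLists (p ∷ P) (q ∷ Q) x with x ≟ p | x ≟ q
... | yes _ | _     = q
... | no _  | yes _ = p
... | no _  | no _  = swapLists P Q x
swapLists _ _ x = x

swapLists-fixes : ∀ P Q {x} → x ∉ P → x ∉ Q → swapLists P Q x ≡ x
swapLists-fixes []      _       _ _ = refl
swapLists-fixes (_ ∷ _) []      _ _ = refl
swapLists-fixes (p ∷ P) (q ∷ Q) {x} x∉p∷P x∉q∷Q with x ≟ p | x ≟ q
... | yes x≡p | _       = contradiction (here x≡p) x∉p∷P
... | no _    | yes x≡q = contradiction (here x≡q) x∉q∷Q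
... | no _    | no _    = swapLists-fixes P Q (x∉p∷P ∘ there) (x∉q∷Q ∘ there)

swapLists-headˡ : ∀ p q P Q → swapLists (p ∷ P) (q ∷ Q) p ≡ q
swapLists-headˡ p q _ _ with p ≟ p | p ≟ q
... | yes _  | _ = refl
... | no p≢p | _ = contradiction refl p≢p

swapLists-headʳ : ∀ p q P Q → p ≢ q → swapLists (p ∷ P) (q ∷ Q) q ≡ p
swapLists-headʳ p q _ _ p≢q with q ≟ p | q ≟ q
... | yes q≡p | _      = contradiction (sym q≡p) p≢q
... | no _    | yes _  = refl
... | no _    | no q≢q = contradiction refl q≢q

swapLists-tail : ∀ {p q x} P Q → x ≢ p → x ≢ q → swapLists (p ∷ P) (q ∷ Q) x ≡ swapLists P Q x
swapLists-tail {p} {q} {x} _ _ x≢p x≢q with x ≟ p | x ≟ q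
... | yes x≡p | _       = contradiction x≡p x≢p
... | no _    | yes x≡q = contradiction x≡q x≢q
... | no _    | no _    = refl

data Swappable : List ℕ → List ℕ → Set where
  []  : Swappable [] []
  _∷_ : ∀ {p q P Q} → p ≢ q × p ∉ P × p ∉ Q × q ∉ P × q ∉ Q → Swappable P Q →
        Swappable (p ∷ P) (q ∷ Q)

swappable : ∀ {P Q} → Linked _<_ P → Linked _<_ Q → Disjoint P Q → length P ≡ length Q →
  Swappable P Q
swappable {[]}    {[]}    _  _  _    _   = []
swappable {p ∷ P} {q ∷ Q} lP lQ P#Q len =
  ( (λ { refl → P#Q (here refl , here refl) })
  , head∉tail lP
  , (λ p∈Q → P#Q (here refl , there p∈Q))
  , (λ q∈P → P#Q (there q∈P , here refl))
  , head∉tail lQ )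
  ∷ swappable (Linked.tail lP) (Linked.tail lQ) (λ (x∈P , x∈Q) → P#Q (there x∈P , there x∈Q))
              (suc-injective len)

swapLists-involutive : ∀ {P Q} → Swappable P Q → ∀ x → swapLists P Q (swapLists P Q x) ≡ x
swapLists-involutive [] x = refl
swapLists-involutive {p ∷ P} {q ∷ Q} ((p≢q , p∉P , p∉Q , q∉P , q∉Q) ∷ s) x with x ≟ p | x ≟ q
... | yes refl | _       = swapLists-headʳ p q P Q p≢q
... | no _     | yes refl = swapLists-headˡ p q P Q
... | no x≢p   | no x≢q  =
  trans (swapLists-tail P Q (avoids x≢p p∉P p∉Q) (avoids x≢q q∉P q∉Q)) (swapLists-involutive s x)
  where
  -- r is fixed by swapLists P Q, so by involutivity only r itself is sent to r
  avoids : ∀ {r} → x ≢ r → r ∉ P → r ∉ Q → swapLists P Q x ≢ r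
  avoids x≢r r∉P r∉Q e =
    x≢r (trans (sym (swapLists-involutive s x)) (trans (cong (swapLists P Q) e) (swapLists-fixes P Q r∉P r∉Q)))

swapLists-⊆ˡ : ∀ {P Q} → Swappable P Q → ∀ {y} → y ∈ P → swapLists P Q y ∈ Q
swapLists-⊆ˡ {p ∷ P} {q ∷ Q} _ (here refl) rewrite swapLists-headˡ p q P Q = here refl
swapLists-⊆ˡ {p ∷ P} {q ∷ Q} ((_ , p∉P , _ , q∉P , _) ∷ s) {y} (there y∈P)
  rewrite swapLists-tail {p} {q} {y} P Q (λ { refl → p∉P y∈P }) (λ { refl → q∉P y∈P })
  = there (swapLists-⊆ˡ s y∈P)

swapLists-⊆ʳ : ∀ {P Q} → Swappable P Q → ∀ {y} → y ∈ Q → swapLists P Q y ∈ P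
swapLists-⊆ʳ {p ∷ P} {q ∷ Q} ((p≢q , _) ∷ _) (here refl) rewrite swapLists-headʳ p q P Q p≢q = here refl
swapLists-⊆ʳ {p ∷ P} {q ∷ Q} ((_ , _ , p∉Q , _ , q∉Q) ∷ s) {y} (there y∈Q)
  rewrite swapLists-tail {p} {q} {y} P Q (λ { refl → p∉Q y∈Q }) (λ { refl → q∉Q y∈Q })
  = there (swapLists-⊆ʳ s y∈Q)

swapPerm : ∀ {P Q} → Swappable P Q → Perm
swapPerm {P} {Q} s = mk↔ₛ′ (swapLists P Q) (swapLists P Q) (swapLists-involutive s) (swapLists-involutive s)

swapPerm-Image : ∀ {n} {w v : NSub n} (s : Swappable (elems w) (elems v)) → Image (swapPerm s) w v
swapPerm-Image s x = mk⇔
  (λ x∈v → _ , swapLists-⊆ʳ s x∈v , swapLists-involutive s x)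
  (λ (y , y∈w , swap-y≡x) → subst (_∈ _) swap-y≡x (swapLists-⊆ˡ s y∈w))

module ClosedSubgroup {n} {M : Fun n → Set} (M-subgroup : Subgroup M) (M-closed : Closed M) where

  ∈-resp-≗ : ∀ {f g} → (∀ u → f u ≡ g u) → M g → M f
  ∈-resp-≗ {f} {g} f≗g g∈M = M-closed f (λ _ → g , g∈M , All.tabulate (λ {u} _ → f≗g u))

  ⊕-∈ : ∀ {f g} → M f → M g → M (f ⊕ g)
  ⊕-∈ = proj₂ M-subgroup _ _

  coset-collision : FiniteIndex M → (h : ℕ → Fun n) → ∃₂ λ i j → i < j × M (h i ⊕ h j)
  coset-collision (gs , covers) h with i , j , i<j , same ← pigeonhole (n<1+n (length gs)) (λ k → Any.index (covers (h (toℕ k))))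
    = toℕ i , toℕ j , i<j , ∈-resp-≗ (λ u → xor-cancel (h (toℕ i) u) (h (toℕ j) u) (g u)) (⊕-∈ hi⊕g∈M hj⊕g∈M)
    where
    g : Fun n
    g = lookup gs (Any.index (covers (h (toℕ i))))
    hi⊕g∈M : M (h (toℕ i) ⊕ g)
    hi⊕g∈M = lookup-index (covers (h (toℕ i)))
    hj⊕g∈M : M (h (toℕ j) ⊕ g)
    hj⊕g∈M = subst (λ c → M (h (toℕ j) ⊕ lookup gs c)) (sym same) (lookup-index (covers (h (toℕ j))))
    xor-cancel : ∀ a b c → (a xor b) ≡ (a xor c) xor (b xor c)
    xor-cancel false false false = refl
    xor-cancel false false true  = refl
    xor-cancel false true  false = refl
    xor-cancel false true  true  = refl
    xor-cancel true  false false = refl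
    xor-cancel true  false true  = refl
    xor-cancel true  true  false = refl
    xor-cancel true  true  true  = refl

  indicators-dense : (∀ w → M (indicator w)) → ∀ f → M f
  indicators-dense indicator∈M f = M-closed f approx
    where
    approx : ∀ ws → ∃ λ g → M g × All (λ w → f w ≡ g w) ws
    approx [] = zeroF , proj₁ M-subgroup , []
    approx (u ∷ ws) with g , g∈M , agree ← approx ws | f u Bool.≟ g u
    ... | yes fu≡gu = g , g∈M , fu≡gu ∷ agree
    ... | no fu≢gu  = indicator u ⊕ g , ⊕-∈ (indicator∈M u) g∈M , flipped-at-u ∷ All.map unchanged agree
      where
      flipped-at-u : f u ≡ indicator u u xor g u
      flipped-at-u with u ≟ₛ u
      ... | yes _   = ¬-not fu≢gu
      ... | no u≢u = contradiction refl u≢u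
      unchanged : ∀ {w} → f w ≡ g w → f w ≡ indicator u w xor g w
      unchanged {w} fw≡gw with w ≟ₛ u
      ... | yes refl = contradiction fw≡gw fu≢gu
      ... | no _     = fw≡gw

indicator-swap : ∀ {n} {M : Fun n → Set} → Invariant M → ∀ {W B C : NSub n} →
  Disjoint (elems B) (elems W) → Disjoint (elems B) (elems C) → Disjoint (elems W) (elems C) →
  M (indicator B ⊕ indicator C) → M (indicator W ⊕ indicator C)
indicator-swap M-invariant {W} {B} {C} B#W B#C W#C B⊕C∈M =
  M-invariant (swapPerm s) _ _ B⊕C∈M
    (IsTranslate-⊕ {σ = swapPerm s} (indicator-translate (swapPerm s) {w = B} {W} (swapPerm-Image {w = B} {W} s))
                   (indicator-translate (swapPerm s) {w = C} {C} (Image-fixed (swapPerm s) {w = C} fixes-C)))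
  where
  s : Swappable (elems B) (elems W)
  s = swappable (elems-linked B) (elems-linked W) B#W (trans (elems-length B) (sym (elems-length W)))
  fixes-C : ∀ {x} → x ∈ elems C → swapLists (elems B) (elems W) x ≡ x
  fixes-C x∈C = swapLists-fixes _ _ (λ x∈B → B#C (x∈B , x∈C)) (λ x∈W → W#C (x∈W , x∈C))

offset-gap : ∀ c n {i j} → i < j → c + i * n + n ≤ c + j * n
offset-gap c n {i} {j} i<j = begin
  c + i * n + n   ≡⟨ +-assoc c (i * n) n ⟩
  c + (i * n + n) ≡⟨ cong (c +_) (+-comm (i * n) n) ⟩
  c + suc i * n   ≤⟨ +-monoʳ-≤ c (*-monoˡ-≤ n i<j) ⟩
  c + j * n       ∎
  where open ≤-Reasoning

module _ {m} {M : Fun (suc m) → Set}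
         (M-subgroup : Subgroup M) (M-invariant : Invariant M) (M-closed : Closed M)
         (M-finiteIndex : FiniteIndex M) where
  open ClosedSubgroup M-subgroup M-closed

  private
    n : ℕ
    n = suc m

  indicator∈ : ∀ w → M (indicator w)
  indicator∈ w = M-closed (indicator w) λ ws →
    approx ws (coset-collision M-finiteIndex (indicator ∘ block ws))
    where
    start : List (NSub n) → ℕ
    start ws = suc (elemsSum (w ∷ ws))

    block : List (NSub n) → ℕ → NSub n
    block ws k = interval (start ws + k * n) n

    approx : ∀ ws → (∃₂ λ i j → i < j × M (indicator (block ws i) ⊕ indicator (block ws j))) →
      ∃ λ g → M g × All (λ u → indicator w u ≡ g u) ws
    approx ws (i , j , i<j , Bi⊕Bj∈M) =
      indicator w ⊕ indicator (block ws j) ,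
      indicator-swap M-invariant (Disjoint.sym (w#B i)) Bi#Bj (w#B j) Bi⊕Bj∈M ,
      All.tabulate agrees
      where
      w#B : ∀ k → Disjoint (elems w) (elems (block ws k))
      w#B k = <-separated⇒Disjoint (s≤s ∘ ∈⇒≤elemsSum {ws = w ∷ ws} (here refl))
                                   (λ y∈B → ≤-trans (m≤m+n (start ws) (k * n)) (interval-lower y∈B))

      Bi#Bj : Disjoint (elems (block ws i)) (elems (block ws j))
      Bi#Bj = <-separated⇒Disjoint (λ x∈Bi → <-≤-trans (interval-upper x∈Bi) (offset-gap (start ws) n i<j))
                                   interval-lower

      -- block ws j starts at or above start ws, beyond every element of u; this needs n ≥ 1
      misses : ∀ {u} → u ∈ ws → indicator (block ws j) u ≡ false
      misses {u} u∈ws with u ≟ₛ block ws j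
      ... | no _     = refl
      ... | yes refl = ⊥-elim (<-irrefl refl (<-≤-trans (s≤s (∈⇒≤elemsSum {ws = w ∷ ws} (there u∈ws) (here refl)))
                                                     (m≤m+n (start ws) (j * n))))

      agrees : ∀ {u} → u ∈ ws → indicator w u ≡ (indicator w ⊕ indicator (block ws j)) u
      agrees {u} u∈ws = trans (sym (xor-identityʳ _)) (cong (indicator w u xor_) (sym (misses u∈ws)))

lemma3p1 : (n : ℕ) → 1 ≤ n → (M : Fun n → Set) →
    ClosedSubmodule M → FiniteIndex M → ¬ Proper M
lemma3p1 (suc m) _ M (M-subgroup , M-invariant , M-closed) M-finiteIndex (f , f∉M) =
  f∉M (indicators-dense (indicator∈ M-subgroup M-invariant M-closed M-finiteIndex) f)
  where open ClosedSubgroup M-subgroup M-closed
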